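{- Let $\gamma$ be a positive integer and let $J$ be a recursively aligned set of unit-length jobs that is $m$-machine $6\gamma$-underallocated. For each window $W$, let $n_W$ be the number of jobs in $J$ with window exactly $W$. Let $J' \subseteq J$ be any subset that contains, for every window $W$, at most $\lceil n_W/m \rceil$ jobs with window $W$. Then $J'$ is $1$-machine $\gamma$-underallocated.
   Context: Each job has length $1$, an integer arrival time $a$ and an integer deadline $d > a$. Its window is $[a,d]$ with span $d-a$, and the job must be scheduled in a unit timeslot inside its window. A window is aligned if its span is $2^i$ for some integer $i \ge 0$ and its start time is a multiple of $2^i$. A set of jobs is recursively aligned if every job's window is aligned. A set of jobs is $m$-machine $\gamma$-underallocated ($\gamma \ge 1$) if it has a feasible schedule on $m$ machines, with no two jobs on the same machine at overlapping times, even when each job's processing time is multiplied by $\gamma$ (each job running entirely within its window). -}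

module Defs where

open import Data.Nat as ℕ using (ℕ; zero; suc; NonZero; _^_)
open import Data.Nat.DivMod using (_/_)
open import Data.Integer as ℤ using (ℤ; +_; _+_; _≤_; _<_)
open import Data.Integer.Divisibility using (_∣_)
open import Data.Integer.Properties using () renaming (_≟_ to _≟ℤ_)
open import Data.Product using (Σ; _×_; _,_; proj₁; proj₂; ∃-syntax)
open import Data.Product.Properties using (≡-dec)
open import Data.Sum using (_⊎_)
open import Data.List using (List; length; filter; lookup)
open import Data.Fin using (Fin)
open import Relation.Binary.PropositionalEquality using (_≡_)
open import Relation.Nullary using (¬_)
open import Relation.Binary.Definitions using (DecidableEquality)

-- A unit job is identified by its window (arrival a , deadline d).
-- Jobs are elements of a list (a multiset: several jobs may share a window).
Window : Set
Window = ℤ × ℤ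

arrival deadline : Window → ℤ
arrival = proj₁
deadline = proj₂

_≟W_ : DecidableEquality Window
_≟W_ = ≡-dec _≟ℤ_ _≟ℤ_

Aligned : Window → Set
Aligned (a , d) = ∃[ i ] ((d ≡ a + + (2 ^ i)) × (+ (2 ^ i) ∣ a))

RecursivelyAligned : List Window → Set
RecursivelyAligned J = ∀ (k : Fin (length J)) → Aligned (lookup J k)

count : Window → List Window → ℕ
count W J = length (filter (_≟W W) J)

⌈_/_⌉ : ℕ → (m : ℕ) → .{{NonZero m}} → ℕ
⌈ n / m ⌉ = (n ℕ.+ (m ℕ.∸ 1)) / m

-- Feasible schedule on m machines when every job's processing time is
-- multiplied by g: each job k gets a machine and an integer start time s
-- with arrival ≤ s and s + g ≤ deadline, and two distinct jobs on the same
-- machine occupy disjoint time intervals [s, s+g).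
Underallocated : (m : ℕ) → (g : ℕ) → List Window → Set
Underallocated m g J =
  Σ (Fin (length J) → Fin m) λ mach →
  Σ (Fin (length J) → ℤ) λ start →
      (∀ (k : Fin (length J)) →
         (arrival (lookup J k) ≤ start k) × (start k + + g ≤ deadline (lookup J k)))
    × (∀ (k l : Fin (length J)) → ¬ (k ≡ l) → mach k ≡ mach l →
         (start k + + g ≤ start l) ⊎ (start l + + g ≤ start k))

-- For a dyadic window D of level i (span 2^i, start a multiple of 2^i) let N(D) and N′(D) count the jobs
-- of J and of J′ whose windows lie inside D, and E(D), E′(D) those whose window is exactly D. The m-machine
-- schedule of J with job length L = 6γ gives N(D) ≤ m ⌊2^i / L⌋, and the ceiling condition gives
-- m E′(D) ≤ E(D) + (m - 1) whenever D can hold a job at all. Splitting D recursively into halves and summing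
-- over its subwindows of span at least L yields L N′(D) ≤ 3 · 2^i. For the power of two 2^p in [γ, 2γ] this
-- is a Hall condition N′(D) · 2^p ≤ 2^i, and because aligned windows are laminar, greedily placing the job
-- with the longest window on a free multiple of 2^p always succeeds: otherwise its window would contain
-- too many jobs.
module Submission where

open import Defs
open import Data.Fin as Fin using (Fin; punchIn; punchOut; toℕ)
import Data.Fin.Properties as Finₚ
open import Data.Integer as ℤ using (ℤ; +_; ∣_∣)
open import Data.Integer.Divisibility.Signed using (_∣_; divides; ∣ᵤ⇒∣; ∣-trans; ∣-refl; ∣m∣n⇒∣m+n)
import Data.Integer.Properties as ℤₚ
import Data.Integer.Tactic.RingSolver as ℤ-Solver
open import Data.List using (List; []; _∷_; length; filter; lookup)
open import Data.List.Membership.Propositional using (_∈_)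
open import Data.List.Membership.Propositional.Properties using (∈-lookup)
open import Data.List.Relation.Binary.Sublist.Propositional using (_⊆_)
import Data.List.Relation.Binary.Sublist.Propositional as Sublist
import Data.List.Relation.Unary.Any as Any
open import Data.List.Relation.Unary.Any.Properties using (lookup-index)
open import Data.Nat as ℕ using (ℕ; zero; suc; _+_; _*_; _∸_; _^_; _⊓_; _≤_; _<_; z≤n; s≤s; NonZero)
open import Data.Nat.DivMod using (_/_; m/n*n≤m; m*n/n≡m; /-monoˡ-≤; m<n⇒m/n≡0)
import Data.Nat.Properties as ℕₚ
open import Algebra.Properties.CommutativeSemigroup ℕₚ.+-commutativeSemigroup using (x∙yz≈y∙xz; interchange)
import Data.Nat.Tactic.RingSolver as ℕ-Solver
open import Data.Product using (Σ; ∃; ∃-syntax; _×_; _,_; proj₁; proj₂)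
open import Data.Sum using (_⊎_; inj₁; inj₂)
open import Data.Unit using (⊤; tt)
open import Data.Vec.Functional using (insertAt; removeAt)
open import Data.Vec.Functional.Properties using (insertAt-lookup; insertAt-punchIn)
open import Function using (_∘_)
open import Function.Definitions using (Injective)
open import Level using (Level)
open import Relation.Binary.Definitions using (tri<; tri≈; tri>) renaming (Decidable to Decidable₂)
open import Relation.Binary.PropositionalEquality
  using (_≡_; _≢_; refl; sym; trans; cong; cong₂; subst; subst₂; module ≡-Reasoning)
open import Relation.Nullary using (¬_; Dec; yes; no; contradiction)
open import Relation.Nullary.Decidable using (_×-dec_; _⊎-dec_)
open import Relation.Unary using (Pred; Decidable)

private
  variable
    ℓ ℓ′ : Level
    A B : Set ℓ
    n M : ℕ

-- Counting and indexing over Fin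

𝟙 : Dec A → ℕ
𝟙 (yes _) = 1
𝟙 (no _)  = 0

𝟙-mono : (A → B) → (a? : Dec A) (b? : Dec B) → 𝟙 a? ≤ 𝟙 b?
𝟙-mono f (yes a) (yes _) = ℕₚ.≤-refl
𝟙-mono f (yes a) (no ¬b) = contradiction (f a) ¬b
𝟙-mono f (no _)  _       = z≤n

𝟙-yes : (a? : Dec A) → A → 𝟙 a? ≡ 1
𝟙-yes (yes _) _ = refl
𝟙-yes (no ¬a) a = contradiction a ¬a

𝟙-⊎ : (a? : Dec A) (b? : Dec B) → (A → ¬ B) → 𝟙 (a? ⊎-dec b?) ≡ 𝟙 a? + 𝟙 b?
𝟙-⊎ (yes a) (yes b) disjoint = contradiction b (disjoint a)
𝟙-⊎ (yes _) (no _)  _        = refl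
𝟙-⊎ (no _)  (yes _) _        = refl
𝟙-⊎ (no _)  (no _)  _        = refl

# : {P : Pred (Fin n) ℓ} → Decidable P → ℕ
# {zero}  P? = 0
# {suc n} P? = 𝟙 (P? Fin.zero) + # (P? ∘ Fin.suc)

#-mono : {P : Pred (Fin n) ℓ} {Q : Pred (Fin n) ℓ′} (P? : Decidable P) (Q? : Decidable Q) →
         (∀ j → P j → Q j) → # P? ≤ # Q?
#-mono {zero}  P? Q? P⇒Q = z≤n
#-mono {suc n} P? Q? P⇒Q =
  ℕₚ.+-mono-≤ (𝟙-mono (P⇒Q Fin.zero) (P? Fin.zero) (Q? Fin.zero)) (#-mono (P? ∘ Fin.suc) (Q? ∘ Fin.suc) (P⇒Q ∘ Fin.suc))

#-cong : {P : Pred (Fin n) ℓ} {Q : Pred (Fin n) ℓ′} (P? : Decidable P) (Q? : Decidable Q) →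
         (∀ j → P j → Q j) → (∀ j → Q j → P j) → # P? ≡ # Q?
#-cong P? Q? P⇒Q Q⇒P = ℕₚ.≤-antisym (#-mono P? Q? P⇒Q) (#-mono Q? P? Q⇒P)

#-all : {P : Pred (Fin n) ℓ} (P? : Decidable P) → (∀ j → P j) → # P? ≡ n
#-all {zero}  P? ∀P = refl
#-all {suc n} P? ∀P with P? Fin.zero
... | yes _  = cong suc (#-all (P? ∘ Fin.suc) (∀P ∘ Fin.suc))
... | no ¬P0 = contradiction (∀P Fin.zero) ¬P0

#-⊎ : {P : Pred (Fin n) ℓ} {Q : Pred (Fin n) ℓ′} (P? : Decidable P) (Q? : Decidable Q) →
      (∀ j → P j → ¬ Q j) → # (λ j → P? j ⊎-dec Q? j) ≡ # P? + # Q?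
#-⊎ {zero}  P? Q? disjoint = refl
#-⊎ {suc n} P? Q? disjoint = trans
  (cong₂ _+_ (𝟙-⊎ (P? Fin.zero) (Q? Fin.zero) (disjoint Fin.zero))
             (#-⊎ (P? ∘ Fin.suc) (Q? ∘ Fin.suc) (disjoint ∘ Fin.suc)))
  (interchange (𝟙 (P? Fin.zero)) (𝟙 (Q? Fin.zero)) (# (P? ∘ Fin.suc)) (# (Q? ∘ Fin.suc)))

#-punchIn : {P : Pred (Fin (suc n)) ℓ} (P? : Decidable P) (k : Fin (suc n)) → # P? ≡ 𝟙 (P? k) + # (P? ∘ punchIn k)
#-punchIn         P? Fin.zero    = refl
#-punchIn {suc n} {P = P} P? (Fin.suc k) = begin
  𝟙 (P? Fin.zero) + # (P? ∘ Fin.suc)                ≡⟨ cong (λ c → 𝟙 (P? Fin.zero) + c) (#-punchIn (P? ∘ Fin.suc) k) ⟩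
  𝟙 (P? Fin.zero) + (𝟙 (P? (Fin.suc k)) + # rest?) ≡⟨ x∙yz≈y∙xz (𝟙 (P? Fin.zero)) (𝟙 (P? (Fin.suc k))) (# rest?) ⟩
  𝟙 (P? (Fin.suc k)) + (𝟙 (P? Fin.zero) + # rest?) ∎
  where
  open ≡-Reasoning
  rest? : Decidable (P ∘ Fin.suc ∘ punchIn k)
  rest? = P? ∘ Fin.suc ∘ punchIn k

#-injective : {P : Pred (Fin n) ℓ} {Q : Pred (Fin M) ℓ′} (P? : Decidable P) (Q? : Decidable Q)
              (h : ∀ j → P j → Fin M) → (∀ j p → Q (h j p)) →
              (∀ {j j′} p p′ → h j p ≡ h j′ p′ → j ≡ j′) → # P? ≤ # Q?
#-injective {n = zero} _ _ _ _ _ = z≤n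
#-injective {n = suc n} P? Q? h hQ h-inj with P? Fin.zero
... | no _ = #-injective (P? ∘ Fin.suc) Q? (h ∘ Fin.suc) (hQ ∘ Fin.suc) (λ p p′ → Finₚ.suc-injective ∘ h-inj p p′)
#-injective {n = suc n} {M = zero}  P? Q? h hQ h-inj | yes p₀ with () ← h Fin.zero p₀
#-injective {n = suc n} {M = suc M} {P = P} {Q = Q} P? Q? h hQ h-inj | yes p₀ = begin
  suc (# (P? ∘ Fin.suc))          ≤⟨ s≤s (#-injective (P? ∘ Fin.suc) (Q? ∘ punchIn y₀) h′ hQ′ h′-inj) ⟩
  suc (# (Q? ∘ punchIn y₀))       ≡⟨ cong (λ c → c + # (Q? ∘ punchIn y₀)) (𝟙-yes (Q? y₀) (hQ Fin.zero p₀)) ⟨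
  𝟙 (Q? y₀) + # (Q? ∘ punchIn y₀) ≡⟨ #-punchIn Q? y₀ ⟨
  # Q?                            ∎
  where
  -- the image of 0 is removed from the target and the remaining images are renumbered by punchOut
  open ℕₚ.≤-Reasoning
  y₀ : Fin (suc M)
  y₀ = h Fin.zero p₀
  y₀≢ : ∀ j p → y₀ ≢ h (Fin.suc j) p
  y₀≢ j p y₀≡ = Finₚ.0≢1+n (h-inj p₀ p y₀≡)
  h′ : ∀ j → P (Fin.suc j) → Fin M
  h′ j p = punchOut (y₀≢ j p)
  hQ′ : ∀ j p → Q (punchIn y₀ (h′ j p))
  hQ′ j p = subst Q (sym (Finₚ.punchIn-punchOut (y₀≢ j p))) (hQ (Fin.suc j) p)
  h′-inj : ∀ {j j′} p p′ → h′ j p ≡ h′ j′ p′ → j ≡ j′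
  h′-inj p p′ = Finₚ.suc-injective ∘ h-inj p p′ ∘ Finₚ.punchOut-injective (y₀≢ _ p) (y₀≢ _ p′)

length-filter≡# : {P : Pred A ℓ} (P? : Decidable P) (xs : List A) → length (filter P? xs) ≡ # (P? ∘ lookup xs)
length-filter≡# P? []       = refl
length-filter≡# P? (x ∷ xs) with P? x
... | yes _ = cong suc (length-filter≡# P? xs)
... | no _  = length-filter≡# P? xs

argmax : (f : Fin (suc n) → ℕ) → ∃ λ k → ∀ j → f j ≤ f k
argmax {zero}  f = Fin.zero , λ { Fin.zero → ℕₚ.≤-refl }
argmax {suc n} f with argmax (f ∘ Fin.suc)
... | k , max with f Fin.zero ℕ.≤? f (Fin.suc k)
...   | yes f0≤fk = Fin.suc k , λ { Fin.zero → f0≤fk ; (Fin.suc j) → max j }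
...   | no f0≰fk  = Fin.zero , λ { Fin.zero    → ℕₚ.≤-refl
                                 ; (Fin.suc j) → ℕₚ.≤-trans (max j) (ℕₚ.<⇒≤ (ℕₚ.≰⇒> f0≰fk)) }

data PunchInView (i : Fin (suc n)) : Fin (suc n) → Set where
  here  : PunchInView i i
  there : ∀ j → PunchInView i (punchIn i j)

punchInView : (i j : Fin (suc n)) → PunchInView i j
punchInView i j with i Fin.≟ j
... | yes refl = here
... | no i≢j   = subst (PunchInView i) (Finₚ.punchIn-punchOut i≢j) (there (punchOut i≢j))

lookup-⊆ : {P : Pred A ℓ} {xs ys : List A} → xs ⊆ ys → (∀ k → P (lookup ys k)) → ∀ k → P (lookup xs k)
lookup-⊆ {P = P} {xs} {ys} xs⊆ys P-ys k = subst P (sym (lookup-index x∈ys)) (P-ys (Any.index x∈ys))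
  where
  x∈ys : lookup xs k ∈ ys
  x∈ys = Sublist.lookup xs⊆ys (∈-lookup k)

-- Aligned windows

+2^_ : ℕ → ℤ
+2^ i = + (2 ^ i)

2^>0 : ∀ i → 0 < 2 ^ i
2^>0 = ℕₚ.m^n>0 2

i<i+2^ : ∀ x i → x ℤ.< x ℤ.+ +2^ i
i<i+2^ x i = subst (ℤ._< x ℤ.+ +2^ i) (ℤₚ.+-identityʳ x) (ℤₚ.+-monoʳ-< x (ℤ.+<+ (2^>0 i)))

+2^-suc : ∀ i → +2^ suc i ≡ +2^ i ℤ.+ +2^ i
+2^-suc i = trans (cong (λ k → + (2 ^ i + k)) (ℕₚ.+-identityʳ (2 ^ i))) (ℤₚ.pos-+ (2 ^ i) (2 ^ i))

2^∣2^ : ∀ {i j} → i ≤ j → +2^ i ∣ +2^ j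
2^∣2^ {i} {j} i≤j = divides (+ (2 ^ (j ∸ i))) (begin
  + (2 ^ j)                 ≡⟨ cong (λ k → + (2 ^ k)) (ℕₚ.m∸n+n≡m i≤j) ⟨
  + (2 ^ (j ∸ i + i))       ≡⟨ cong +_ (ℕₚ.^-distribˡ-+-* 2 (j ∸ i) i) ⟩
  + (2 ^ (j ∸ i) * 2 ^ i)   ≡⟨ ℤₚ.pos-* (2 ^ (j ∸ i)) (2 ^ i) ⟩
  + (2 ^ (j ∸ i)) ℤ.* +2^ i ∎)
  where open ≡-Reasoning

∣∣<⇒+≤ : ∀ {q u v} → + q ∣ u → + q ∣ v → u ℤ.< v → u ℤ.+ + q ℤ.≤ v
∣∣<⇒+≤ {q} (divides a refl) (divides b refl) aq<bq = begin
  a ℤ.* + q ℤ.+ + q  ≡⟨ ℤₚ.+-comm (a ℤ.* + q) (+ q) ⟩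
  + q ℤ.+ a ℤ.* + q  ≡⟨ ℤₚ.suc-* a (+ q) ⟨
  ℤ.suc a ℤ.* + q    ≤⟨ ℤₚ.*-monoʳ-≤-nonNeg (+ q) (ℤₚ.i<j⇒suc[i]≤j (ℤₚ.*-cancelʳ-<-nonNeg {a} {b} (+ q) aq<bq)) ⟩
  b ℤ.* + q          ∎
  where open ℤₚ.≤-Reasoning

∣∣<+⇒≤ : ∀ {q u v} → + q ∣ u → + q ∣ v → u ℤ.< v ℤ.+ + q → u ℤ.≤ v
∣∣<+⇒≤ q∣u q∣v u<v+q = ℤₚ.≮⇒≥ (λ v<u → ℤₚ.<⇒≱ u<v+q (∣∣<⇒+≤ q∣v q∣u v<u))

dyadic : ℤ → ℕ → Window
dyadic a i = a , a ℤ.+ +2^ i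

record AlignedAt (i : ℕ) (W : Window) : Set where
  constructor aligned
  field
    deadline≡ : deadline W ≡ arrival W ℤ.+ +2^ i
    2^∣arrival : +2^ i ∣ arrival W

aligned⇒alignedAt : ∀ {W} → Aligned W → ∃[ i ] AlignedAt i W
aligned⇒alignedAt (i , d≡a+2^i , 2^i∣a) = i , aligned d≡a+2^i (∣ᵤ⇒∣ 2^i∣a)

alignedAt⇒≡dyadic : ∀ {i W} → AlignedAt i W → W ≡ dyadic (arrival W) i
alignedAt⇒≡dyadic {W = _ , _} (aligned refl _) = refl

_⊑_ : Window → Window → Set
V ⊑ W = (arrival W ℤ.≤ arrival V) × (deadline V ℤ.≤ deadline W)

_⊑?_ : Decidable₂ _⊑_
V ⊑? W = (arrival W ℤₚ.≤? arrival V) ×-dec (deadline V ℤₚ.≤? deadline W)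

⊑-reflexive : ∀ {V W} → V ≡ W → V ⊑ W
⊑-reflexive refl = ℤₚ.≤-refl , ℤₚ.≤-refl

⊑-trans : ∀ {U V W} → U ⊑ V → V ⊑ W → U ⊑ W
⊑-trans (a₁ , d₁) (a₂ , d₂) = ℤₚ.≤-trans a₂ a₁ , ℤₚ.≤-trans d₁ d₂

⊑-antisym : ∀ {V W} → V ⊑ W → W ⊑ V → V ≡ W
⊑-antisym (a₁ , d₁) (a₂ , d₂) = cong₂ _,_ (ℤₚ.≤-antisym a₂ a₁) (ℤₚ.≤-antisym d₁ d₂)

-- the unit timeslot [x, x + 1] lies in W
_∈ʷ_ : ℤ → Window → Set
x ∈ʷ W = (arrival W ℤ.≤ x) × (x ℤ.< deadline W)

arrival∈ʷ : ∀ {i W} → AlignedAt i W → arrival W ∈ʷ W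
arrival∈ʷ {i} {c , _} (aligned refl _) = ℤₚ.≤-refl , i<i+2^ c i

-- All four endpoints are multiples of 2^i, so two windows sharing a timeslot are nested.
aligned-laminar : ∀ {i j V W x} → i ≤ j → AlignedAt i V → AlignedAt j W → x ∈ʷ V → x ∈ʷ W → V ⊑ W
aligned-laminar {i} {j} {b , _} {c , _} i≤j (aligned refl 2^i∣b) (aligned refl 2^j∣c) (b≤x , x<b+2^i) (c≤x , x<c+2^j) =
  ∣∣<+⇒≤ 2^i∣c 2^i∣b (ℤₚ.≤-<-trans c≤x x<b+2^i) ,
  ∣∣<⇒+≤ 2^i∣b (∣m∣n⇒∣m+n 2^i∣c (2^∣2^ i≤j)) (ℤₚ.≤-<-trans b≤x x<c+2^j)
  where
  2^i∣c : +2^ i ∣ c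
  2^i∣c = ∣-trans (2^∣2^ i≤j) 2^j∣c

aligned-⊑⇒≡ : ∀ {i j V W} → i ≤ j → AlignedAt i V → AlignedAt j W → W ⊑ V → W ≡ V
aligned-⊑⇒≡ i≤j alV alW W⊑V@(a≤c , d≤) =
  ⊑-antisym W⊑V (aligned-laminar i≤j alV alW (a≤c , ℤₚ.<-≤-trans (proj₂ (arrival∈ʷ alW)) d≤) (arrival∈ʷ alW))

inside : (Fin n → Window) → Window → ℕ
inside w D = # (λ k → w k ⊑? D)

exactly : (Fin n → Window) → Window → ℕ
exactly w D = # (λ k → w k ≟W D)

exactly≤inside : (w : Fin n → Window) (D : Window) → exactly w D ≤ inside w D
exactly≤inside w D = #-mono (λ k → w k ≟W D) (λ k → w k ⊑? D) (λ _ → ⊑-reflexive)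

inside≤exactly-level0 : ∀ {a} → +2^ 0 ∣ a → (w : Fin n → Window) → (∀ k → ∃[ j ] AlignedAt j (w k)) →
                        inside w (dyadic a 0) ≤ exactly w (dyadic a 0)
inside≤exactly-level0 1∣a w al =
  #-mono (λ k → w k ⊑? _) (λ k → w k ≟W _) (λ k → aligned-⊑⇒≡ z≤n (aligned refl 1∣a) (proj₂ (al k)))

count≡exactly : ∀ {W} xs → count W xs ≡ exactly (lookup xs) W
count≡exactly {W} = length-filter≡# (_≟W W)

module _ {a : ℤ} {i : ℕ} (2^i⁺¹∣a : +2^ suc i ∣ a) where

  private
    D lower upper : Window
    D = dyadic a (suc i)
    lower = dyadic a i
    upper = dyadic (a ℤ.+ +2^ i) i

    upper-deadline : a ℤ.+ +2^ suc i ≡ (a ℤ.+ +2^ i) ℤ.+ +2^ i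
    upper-deadline = trans (cong (λ x → a ℤ.+ x) (+2^-suc i)) (sym (ℤₚ.+-assoc a (+2^ i) (+2^ i)))

    2^i∣a : +2^ i ∣ a
    2^i∣a = ∣-trans (2^∣2^ (ℕₚ.n≤1+n i)) 2^i⁺¹∣a

    lower⊑D : lower ⊑ D
    lower⊑D = ℤₚ.≤-refl , ℤₚ.+-monoʳ-≤ a (ℤ.+≤+ (ℕₚ.^-monoʳ-≤ 2 (ℕₚ.n≤1+n i)))

    upper⊑D : upper ⊑ D
    upper⊑D = ℤₚ.<⇒≤ (i<i+2^ a i) , ℤₚ.≤-reflexive (sym upper-deadline)

  ⊑-halves : ∀ {j W} → AlignedAt j W → W ⊑ D → W ≡ D ⊎ W ⊑ lower ⊎ W ⊑ upper
  ⊑-halves {j} {W} alW W⊑D with j ℕ.≤? i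
  ... | no j≰i = inj₁ (aligned-⊑⇒≡ (ℕₚ.≰⇒> j≰i) (aligned refl 2^i⁺¹∣a) alW W⊑D)
  ... | yes j≤i with arrival W ℤₚ.<? a ℤ.+ +2^ i
  ...   | yes c<a+2^i =
    inj₂ (inj₁ (aligned-laminar j≤i alW (aligned refl 2^i∣a) (arrival∈ʷ alW) (proj₁ W⊑D , c<a+2^i)))
  ...   | no c≮a+2^i =
    inj₂ (inj₂ (aligned-laminar j≤i alW (aligned refl (∣m∣n⇒∣m+n 2^i∣a ∣-refl)) (arrival∈ʷ alW)
      (ℤₚ.≮⇒≥ c≮a+2^i , subst (arrival W ℤ.<_) upper-deadline (ℤₚ.<-≤-trans (proj₂ (arrival∈ʷ alW)) (proj₂ W⊑D)))))

  ≡D⇒⋢halves : ∀ {W} → W ≡ D → ¬ (W ⊑ lower ⊎ W ⊑ upper)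
  ≡D⇒⋢halves refl (inj₁ (_ , d≤)) = ℤₚ.<⇒≱ (subst (a ℤ.+ +2^ i ℤ.<_) (sym upper-deadline) (i<i+2^ (a ℤ.+ +2^ i) i)) d≤
  ≡D⇒⋢halves refl (inj₂ (a≤ , _)) = ℤₚ.<⇒≱ (i<i+2^ a i) a≤

  ⊑lower⇒⋢upper : ∀ {j W} → AlignedAt j W → W ⊑ lower → ¬ W ⊑ upper
  ⊑lower⇒⋢upper alW (_ , d≤) (≤c , _) = ℤₚ.<⇒≱ (proj₂ (arrival∈ʷ alW)) (ℤₚ.≤-trans d≤ ≤c)

  inside-halves : (w : Fin n → Window) → (∀ k → ∃[ j ] AlignedAt j (w k)) →
                  inside w D ≡ exactly w D + (inside w lower + inside w upper)
  inside-halves w al = begin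
    inside w D                                              ≡⟨ #-cong (λ k → w k ⊑? D) trichotomy?
                                                                 (λ k → ⊑-halves (proj₂ (al k))) into-D ⟩
    # trichotomy?                                           ≡⟨ #-⊎ (λ k → w k ≟W D) _ (λ k → ≡D⇒⋢halves) ⟩
    exactly w D + # (λ k → w k ⊑? lower ⊎-dec w k ⊑? upper) ≡⟨ cong (λ c → exactly w D + c)
                                                                 (#-⊎ (λ k → w k ⊑? lower) (λ k → w k ⊑? upper)
                                                                      (λ k → ⊑lower⇒⋢upper (proj₂ (al k)))) ⟩
    exactly w D + (inside w lower + inside w upper)         ∎
    where
    open ≡-Reasoning
    trichotomy? : Decidable (λ k → w k ≡ D ⊎ w k ⊑ lower ⊎ w k ⊑ upper)
    trichotomy? k = w k ≟W D ⊎-dec (w k ⊑? lower ⊎-dec w k ⊑? upper)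
    into-D : ∀ k → w k ≡ D ⊎ w k ⊑ lower ⊎ w k ⊑ upper → w k ⊑ D
    into-D k (inj₁ k≡D)            = ⊑-reflexive k≡D
    into-D k (inj₂ (inj₁ k⊑lower)) = ⊑-trans k⊑lower lower⊑D
    into-D k (inj₂ (inj₂ k⊑upper)) = ⊑-trans k⊑upper upper⊑D

-- Capacity of an m-machine schedule

offset : ℤ → ℤ → ℕ
offset a x = ∣ x ℤ.- a ∣

+offset : ∀ {a x} → a ℤ.≤ x → + offset a x ≡ x ℤ.- a
+offset a≤x = ℤₚ.0≤i⇒+∣i∣≡i (ℤₚ.i≤j⇒0≤j-i a≤x)

offset-+ : ∀ a k → offset a (a ℤ.+ + k) ≡ k
offset-+ a k = cong ∣_∣ (a+k-a≡k a (+ k))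
  where
  a+k-a≡k : ∀ a k → a ℤ.+ k ℤ.- a ≡ k
  a+k-a≡k = ℤ-Solver.solve-∀

offset-+-mono-≤ : ∀ {a x y L} → a ℤ.≤ x → x ℤ.+ + L ℤ.≤ y → offset a x + L ≤ offset a y
offset-+-mono-≤ {a} {x} {y} {L} a≤x x+L≤y = ℤₚ.drop‿+≤+ (begin
  + (offset a x + L)      ≡⟨ ℤₚ.pos-+ (offset a x) L ⟩
  + offset a x ℤ.+ + L    ≡⟨ cong (ℤ._+ + L) (+offset a≤x) ⟩
  x ℤ.- a ℤ.+ + L         ≡⟨ x-a+L≡x+L-a x a (+ L) ⟩
  (x ℤ.+ + L) ℤ.- a       ≤⟨ ℤₚ.+-monoˡ-≤ (ℤ.- a) x+L≤y ⟩
  y ℤ.- a                 ≡⟨ +offset (ℤₚ.≤-trans (ℤₚ.≤-trans a≤x (ℤₚ.i≤i+j x (+ L))) x+L≤y) ⟨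
  + offset a y            ∎)
  where
  open ℤₚ.≤-Reasoning
  x-a+L≡x+L-a : ∀ x a L → x ℤ.- a ℤ.+ L ≡ (x ℤ.+ L) ℤ.- a
  x-a+L≡x+L-a = ℤ-Solver.solve-∀

+≤⇒/< : ∀ {x y} L .{{_ : NonZero L}} → x + L ≤ y → x / L < y / L
+≤⇒/< {x} {y} L x+L≤y = begin-strict
  x / L                 <⟨ ℕₚ.n<1+n (x / L) ⟩
  suc (x / L)           ≡⟨ m*n/n≡m (suc (x / L)) L ⟨
  suc (x / L) * L / L   ≤⟨ /-monoˡ-≤ L (begin
    L + x / L * L         ≤⟨ ℕₚ.+-monoʳ-≤ L (m/n*n≤m x L) ⟩
    L + x                 ≡⟨ ℕₚ.+-comm L x ⟩
    x + L                 ≤⟨ x+L≤y ⟩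
    y                     ∎) ⟩
  y / L                 ∎
  where open ℕₚ.≤-Reasoning

capacity : ∀ {m L J} .{{_ : NonZero L}} → Underallocated m L J →
           ∀ a P → inside (lookup J) (a , a ℤ.+ + P) ≤ m * (P / L)
capacity {m} {L} {J} (machine , start , fits , disjoint) a P = begin
  inside (lookup J) D            ≤⟨ #-injective (λ k → lookup J k ⊑? D) (λ (_ : Fin (m * (P / L))) → yes tt)
                                      slot (λ _ _ → tt) slot-injective ⟩
  # {m * (P / L)} (λ _ → yes tt) ≡⟨ #-all (λ _ → yes tt) (λ _ → tt) ⟩
  m * (P / L)                    ∎
  where
  -- a job inside D is identified by its machine and by the length-L bucket of D in which it starts
  open ℕₚ.≤-Reasoning hiding (start)
  D : Window
  D = a , a ℤ.+ + P
  a≤start : ∀ {k} → lookup J k ⊑ D → a ℤ.≤ start k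
  a≤start {k} (a≤ , _) = ℤₚ.≤-trans a≤ (proj₁ (fits k))
  bucket : ∀ k → lookup J k ⊑ D → offset a (start k) / L < P / L
  bucket k k⊑D = +≤⇒/< L (subst (offset a (start k) + L ≤_) (offset-+ a P)
                   (offset-+-mono-≤ (a≤start k⊑D) (ℤₚ.≤-trans (proj₂ (fits k)) (proj₂ k⊑D))))
  slot : ∀ k → lookup J k ⊑ D → Fin (m * (P / L))
  slot k k⊑D = Fin.combine (machine k) (Fin.fromℕ< (bucket k k⊑D))
  slot-injective : ∀ {k l} p q → slot k p ≡ slot l q → k ≡ l
  slot-injective {k} {l} k⊑D l⊑D eq with k Fin.≟ l
  ... | yes k≡l = k≡l
  ... | no k≢l with disjoint k l k≢l (proj₁ same) | same-bucket
    where
    same : machine k ≡ machine l × Fin.fromℕ< (bucket k k⊑D) ≡ Fin.fromℕ< (bucket l l⊑D)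
    same = Finₚ.combine-injective _ _ _ _ eq
    same-bucket : offset a (start k) / L ≡ offset a (start l) / L
    same-bucket = trans (sym (Finₚ.toℕ-fromℕ< (bucket k k⊑D)))
                    (trans (cong toℕ (proj₂ same)) (Finₚ.toℕ-fromℕ< (bucket l l⊑D)))
  ... | inj₁ k-before-l | b≡ = contradiction b≡ (ℕₚ.<⇒≢ (+≤⇒/< L (offset-+-mono-≤ (a≤start k⊑D) k-before-l)))
  ... | inj₂ l-before-k | b≡ = contradiction (sym b≡) (ℕₚ.<⇒≢ (+≤⇒/< L (offset-+-mono-≤ (a≤start l⊑D) l-before-k)))

fits⇒≤2^ : ∀ {m L J j} → Underallocated m L J → ∀ k → AlignedAt j (lookup J k) → L ≤ 2 ^ j
fits⇒≤2^ {L = L} {J} {j} (_ , start , fits , _) k (aligned d≡a+2^j _) =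
  ℕₚ.≤-trans (ℕₚ.m≤n+m L (offset a (start k))) (subst (offset a (start k) + L ≤_) (offset-+ a (2 ^ j))
    (offset-+-mono-≤ (proj₁ (fits k)) (subst (start k ℤ.+ + L ℤ.≤_) d≡a+2^j (proj₂ (fits k)))))
  where
  a : ℤ
  a = arrival (lookup J k)

LongAligned : ℕ → Window → Set
LongAligned L W = ∃[ j ] (AlignedAt j W × L ≤ 2 ^ j)

underallocated⇒longAligned : ∀ {m L J} → RecursivelyAligned J → Underallocated m L J → ∀ k → LongAligned L (lookup J k)
underallocated⇒longAligned {J = J} J-aligned U k with aligned⇒alignedAt (J-aligned k)
... | j , al = j , al , fits⇒≤2^ {J = J} U k al

-- The density of J′ in dyadic windows

≤⌈/⌉⇒*≤ : ∀ {e e′ m} .{{_ : NonZero m}} → e′ ≤ ⌈ e / m ⌉ → m * e′ ≤ e + (m ∸ 1)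
≤⌈/⌉⇒*≤ {e} {e′} {m} e′≤ = begin
  m * e′                     ≤⟨ ℕₚ.*-monoʳ-≤ m e′≤ ⟩
  m * ((e + (m ∸ 1)) / m)    ≡⟨ ℕₚ.*-comm m _ ⟩
  (e + (m ∸ 1)) / m * m      ≤⟨ m/n*n≤m (e + (m ∸ 1)) m ⟩
  e + (m ∸ 1)                ∎
  where open ℕₚ.≤-Reasoning

⌈0/m⌉≡0 : ∀ m .{{_ : NonZero m}} → ⌈ 0 / m ⌉ ≡ 0
⌈0/m⌉≡0 (suc m) = m<n⇒m/n≡0 (ℕₚ.n<1+n m)

module _ (L : ℕ) .{{_ : NonZero L}} where

  slots : ℕ → ℕ
  slots i = 2 ^ i / L

  -- the number of dyadic subwindows (of all levels) of a level-i window that are at least L long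
  roomy : ℕ → ℕ
  roomy zero    = 1 ⊓ slots zero
  roomy (suc i) = 1 ⊓ slots (suc i) + 2 * roomy i

  L*slots≤2^ : ∀ i → L * slots i ≤ 2 ^ i
  L*slots≤2^ i = subst (_≤ 2 ^ i) (ℕₚ.*-comm (slots i) L) (m/n*n≤m (2 ^ i) L)

  2*slots≤slots-suc : ∀ i → 2 * slots i ≤ slots (suc i)
  2*slots≤slots-suc i = begin
    2 * slots i               ≡⟨ m*n/n≡m (2 * slots i) L ⟨
    2 * slots i * L / L       ≤⟨ /-monoˡ-≤ L (subst (_≤ 2 * 2 ^ i) (sym (ℕₚ.*-assoc 2 (slots i) L))
                                   (ℕₚ.*-monoʳ-≤ 2 (m/n*n≤m (2 ^ i) L))) ⟩
    slots (suc i)             ∎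
    where open ℕₚ.≤-Reasoning

  roomy+≤2*slots : ∀ i → roomy i + 1 ⊓ slots i ≤ 2 * slots i
  roomy+≤2*slots zero    = subst (_≤ 2 * slots 0) (2x≡x+x (1 ⊓ slots 0)) (ℕₚ.*-monoʳ-≤ 2 (ℕₚ.m⊓n≤n 1 (slots 0)))
    where
    2x≡x+x : ∀ x → 2 * x ≡ x + x
    2x≡x+x = ℕ-Solver.solve-∀
  roomy+≤2*slots (suc i) = doubling (roomy i) (slots i) (slots (suc i)) (roomy+≤2*slots i) (2*slots≤slots-suc i)
    where
    open ℕₚ.≤-Reasoning
    doubling : ∀ r q q′ → r + 1 ⊓ q ≤ 2 * q → 2 * q ≤ q′ → (1 ⊓ q′ + 2 * r) + 1 ⊓ q′ ≤ 2 * q′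
    doubling r zero q′ r+0≤0 _ with refl ← ℕₚ.n≤0⇒n≡0 (subst (_≤ 0) (ℕₚ.+-identityʳ r) r+0≤0) = begin
      1 ⊓ q′ + 0 + 1 ⊓ q′  ≡⟨ x+0+x≡2x (1 ⊓ q′) ⟩
      2 * (1 ⊓ q′)         ≤⟨ ℕₚ.*-monoʳ-≤ 2 (ℕₚ.m⊓n≤n 1 q′) ⟩
      2 * q′               ∎
      where
      x+0+x≡2x : ∀ x → x + 0 + x ≡ 2 * x
      x+0+x≡2x = ℕ-Solver.solve-∀
    doubling r (suc q) (suc q′) r+1≤2q 2q≤q′ = begin
      1 + 2 * r + 1        ≡⟨ 1+2r+1≡2[r+1] r ⟩
      2 * (r + 1)          ≤⟨ ℕₚ.*-monoʳ-≤ 2 (ℕₚ.≤-trans r+1≤2q 2q≤q′) ⟩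
      2 * suc q′           ∎
      where
      1+2r+1≡2[r+1] : ∀ r → 1 + 2 * r + 1 ≡ 2 * (r + 1)
      1+2r+1≡2[r+1] = ℕ-Solver.solve-∀

  L*roomy≤2*2^ : ∀ i → L * roomy i ≤ 2 * 2 ^ i
  L*roomy≤2*2^ i = begin
    L * roomy i        ≤⟨ ℕₚ.*-monoʳ-≤ L (ℕₚ.≤-trans (ℕₚ.m≤m+n (roomy i) _) (roomy+≤2*slots i)) ⟩
    L * (2 * slots i)  ≡⟨ x[2y]≡2[xy] L (slots i) ⟩
    2 * (L * slots i)  ≤⟨ ℕₚ.*-monoʳ-≤ 2 (L*slots≤2^ i) ⟩
    2 * 2 ^ i          ∎
    where
    open ℕₚ.≤-Reasoning
    x[2y]≡2[xy] : ∀ x y → x * (2 * y) ≡ 2 * (x * y)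
    x[2y]≡2[xy] = ℕ-Solver.solve-∀

module _ {m L : ℕ} .{{_ : NonZero m}} .{{_ : NonZero L}} {J J′ : List Window}
         (U : Underallocated m L J)
         (J-aligned : ∀ k → ∃[ j ] AlignedAt j (lookup J k))
         (J′-aligned : ∀ k → ∃[ j ] AlignedAt j (lookup J′ k))
         (J′-few : ∀ W → count W J′ ≤ ⌈ count W J / m ⌉) where

  private
    N N′ E E′ : Window → ℕ
    N  = inside (lookup J)
    N′ = inside (lookup J′)
    E  = exactly (lookup J)
    E′ = exactly (lookup J′)

    E′≤⌈E/m⌉ : ∀ W → E′ W ≤ ⌈ E W / m ⌉
    E′≤⌈E/m⌉ W = subst₂ (λ e′ e → e′ ≤ ⌈ e / m ⌉) (count≡exactly J′) (count≡exactly J) (J′-few W)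

  -- If no job fits into the window then J has no job there, hence neither has J′.
  E′-bound : ∀ a i → m * E′ (dyadic a i) ≤ E (dyadic a i) + (m ∸ 1) * (1 ⊓ slots L i)
  E′-bound a i with slots L i in slots≡
  ... | suc _ = subst (λ c → m * E′ (dyadic a i) ≤ E (dyadic a i) + c) (sym (ℕₚ.*-identityʳ (m ∸ 1)))
                  (≤⌈/⌉⇒*≤ (E′≤⌈E/m⌉ (dyadic a i)))
  ... | zero  = begin
    m * E′ (dyadic a i)           ≡⟨ cong (m *_) E′≡0 ⟩
    m * 0                         ≡⟨ ℕₚ.*-zeroʳ m ⟩
    0                             ≤⟨ z≤n ⟩
    E (dyadic a i) + (m ∸ 1) * 0  ∎
    where
    open ℕₚ.≤-Reasoning
    E≤0 : E (dyadic a i) ≤ 0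
    E≤0 = begin
      E (dyadic a i)  ≤⟨ exactly≤inside (lookup J) (dyadic a i) ⟩
      N (dyadic a i)  ≤⟨ capacity {J = J} U a (2 ^ i) ⟩
      m * slots L i   ≡⟨ cong (m *_) slots≡ ⟩
      m * 0           ≡⟨ ℕₚ.*-zeroʳ m ⟩
      0               ∎
    E′≡0 : E′ (dyadic a i) ≡ 0
    E′≡0 = ℕₚ.n≤0⇒n≡0 (begin
      E′ (dyadic a i)          ≤⟨ E′≤⌈E/m⌉ (dyadic a i) ⟩
      ⌈ E (dyadic a i) / m ⌉   ≡⟨ cong (λ e → ⌈ e / m ⌉) (ℕₚ.n≤0⇒n≡0 E≤0) ⟩
      ⌈ 0 / m ⌉                ≡⟨ ⌈0/m⌉≡0 m ⟩
      0                        ∎)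

  N′-bound : ∀ i a → +2^ i ∣ a → m * N′ (dyadic a i) ≤ N (dyadic a i) + (m ∸ 1) * roomy L i
  N′-bound zero a 1∣a = begin
    m * N′ D                         ≤⟨ ℕₚ.*-monoʳ-≤ m (inside≤exactly-level0 1∣a (lookup J′) J′-aligned) ⟩
    m * E′ D                         ≤⟨ E′-bound a 0 ⟩
    E D + (m ∸ 1) * (1 ⊓ slots L 0)  ≤⟨ ℕₚ.+-monoˡ-≤ _ (exactly≤inside (lookup J) D) ⟩
    N D + (m ∸ 1) * roomy L 0        ∎
    where
    open ℕₚ.≤-Reasoning
    D : Window
    D = dyadic a 0
  N′-bound (suc i) a 2^i⁺¹∣a = begin
    m * N′ D                                                    ≡⟨ cong (m *_) (halves (lookup J′) J′-aligned) ⟩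
    m * (E′ D + (N′ lower + N′ upper))                          ≡⟨ distrib m (E′ D) (N′ lower) (N′ upper) ⟩
    m * E′ D + (m * N′ lower + m * N′ upper)                    ≤⟨ ℕₚ.+-mono-≤ (E′-bound a (suc i))
                                                                     (ℕₚ.+-mono-≤ (N′-bound i a 2^i∣a)
                                                                                  (N′-bound i (a ℤ.+ +2^ i) 2^i∣a+2^i)) ⟩
    (E D + c * (1 ⊓ slots L (suc i)))
      + ((N lower + c * roomy L i) + (N upper + c * roomy L i)) ≡⟨ regroup (E D) (N lower) (N upper) c (1 ⊓ slots L (suc i)) (roomy L i) ⟩
    (E D + (N lower + N upper)) + c * roomy L (suc i)           ≡⟨ cong (λ x → x + c * roomy L (suc i)) (halves (lookup J) J-aligned) ⟨
    N D + c * roomy L (suc i)                                   ∎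
    where
    open ℕₚ.≤-Reasoning
    c : ℕ
    c = m ∸ 1
    D lower upper : Window
    D = dyadic a (suc i)
    lower = dyadic a i
    upper = dyadic (a ℤ.+ +2^ i) i
    2^i∣a : +2^ i ∣ a
    2^i∣a = ∣-trans (2^∣2^ (ℕₚ.n≤1+n i)) 2^i⁺¹∣a
    2^i∣a+2^i : +2^ i ∣ a ℤ.+ +2^ i
    2^i∣a+2^i = ∣m∣n⇒∣m+n 2^i∣a ∣-refl
    halves : (w : Fin n → Window) → (∀ k → ∃[ j ] AlignedAt j (w k)) →
             inside w D ≡ exactly w D + (inside w lower + inside w upper)
    halves = inside-halves {i = i} 2^i⁺¹∣a
    distrib : ∀ m e x y → m * (e + (x + y)) ≡ m * e + (m * x + m * y)
    distrib = ℕ-Solver.solve-∀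
    regroup : ∀ e x y c t r → (e + c * t) + ((x + c * r) + (y + c * r)) ≡ (e + (x + y)) + c * (t + 2 * r)
    regroup = ℕ-Solver.solve-∀

  L*N′≤3*2^ : ∀ i a → +2^ i ∣ a → L * N′ (dyadic a i) ≤ 3 * 2 ^ i
  L*N′≤3*2^ i a 2^i∣a = ℕₚ.*-cancelˡ-≤ m (begin
    m * (L * N′ D)                       ≡⟨ x[yz]≡y[xz] m L (N′ D) ⟩
    L * (m * N′ D)                       ≤⟨ ℕₚ.*-monoʳ-≤ L (N′-bound i a 2^i∣a) ⟩
    L * (N D + (m ∸ 1) * roomy L i)      ≡⟨ ℕₚ.*-distribˡ-+ L (N D) _ ⟩
    L * N D + L * ((m ∸ 1) * roomy L i)  ≡⟨ cong (λ x → L * N D + x) (x[yz]≡y[xz] L (m ∸ 1) (roomy L i)) ⟩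
    L * N D + (m ∸ 1) * (L * roomy L i)  ≤⟨ ℕₚ.+-mono-≤ L*N≤m*2^i (ℕₚ.*-mono-≤ (ℕₚ.m∸n≤m m 1) (L*roomy≤2*2^ L i)) ⟩
    m * 2 ^ i + m * (2 * 2 ^ i)          ≡⟨ xy+x[2y]≡x[3y] m (2 ^ i) ⟩
    m * (3 * 2 ^ i)                      ∎)
    where
    open ℕₚ.≤-Reasoning
    D : Window
    D = dyadic a i
    x[yz]≡y[xz] : ∀ x y z → x * (y * z) ≡ y * (x * z)
    x[yz]≡y[xz] = ℕ-Solver.solve-∀
    xy+x[2y]≡x[3y] : ∀ x y → x * y + x * (2 * y) ≡ x * (3 * y)
    xy+x[2y]≡x[3y] = ℕ-Solver.solve-∀
    L*N≤m*2^i : L * N D ≤ m * 2 ^ i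
    L*N≤m*2^i = begin
      L * N D             ≤⟨ ℕₚ.*-monoʳ-≤ L (capacity {J = J} U a (2 ^ i)) ⟩
      L * (m * slots L i) ≡⟨ x[yz]≡y[xz] L m (slots L i) ⟩
      m * (L * slots L i) ≤⟨ ℕₚ.*-monoʳ-≤ m (L*slots≤2^ L i) ⟩
      m * 2 ^ i           ∎

-- Scheduling J′ on one machine

module _ (p : ℕ) where

  private instance
    2^p≢0 : NonZero (2 ^ p)
    2^p≢0 = ℕ.>-nonZero (2^>0 p)

  Slot : Window → ℤ → Set
  Slot W x = (+2^ p ∣ x) × (arrival W ℤ.≤ x) × (x ℤ.+ +2^ p ℤ.≤ deadline W)

  slot⇒∈ʷ : ∀ {W x} → Slot W x → x ∈ʷ W
  slot⇒∈ʷ {x = x} (_ , a≤x , x+2^p≤d) = a≤x , ℤₚ.<-≤-trans (i<i+2^ x p) x+2^p≤d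

  Schedule : (Fin n → Window) → Set
  Schedule {n} w = Σ (Fin n → ℤ) λ s → (∀ k → Slot (w k) (s k)) × Injective _≡_ _≡_ s

  insertAt-schedule : (w : Fin (suc n) → Window) (k₀ : Fin (suc n)) {x : ℤ} → Slot (w k₀) x →
                      ((s′ , _) : Schedule (removeAt w k₀)) → (∀ j → s′ j ≢ x) → Schedule w
  insertAt-schedule w k₀ {x} x-slot (s′ , s′-slot , s′-injective) free = s , s-slot , s-injective
    where
    s : Fin _ → ℤ
    s = insertAt s′ k₀ x
    s-slot : ∀ k → Slot (w k) (s k)
    s-slot k with punchInView k₀ k
    ... | here    = subst (Slot (w k₀)) (sym (insertAt-lookup s′ k₀ x)) x-slot
    ... | there j = subst (Slot (w (punchIn k₀ j))) (sym (insertAt-punchIn s′ k₀ x j)) (s′-slot j)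
    s-injective : Injective _≡_ _≡_ s
    s-injective {k} {l} sk≡sl with punchInView k₀ k | punchInView k₀ l
    ... | here    | here     = refl
    ... | here    | there j  =
      contradiction (trans (sym (insertAt-punchIn s′ k₀ x j)) (trans (sym sk≡sl) (insertAt-lookup s′ k₀ x))) (free j)
    ... | there j | here     =
      contradiction (trans (sym (insertAt-punchIn s′ k₀ x j)) (trans sk≡sl (insertAt-lookup s′ k₀ x))) (free j)
    ... | there j | there j′ =
      cong (punchIn k₀) (s′-injective (trans (sym (insertAt-punchIn s′ k₀ x j)) (trans sk≡sl (insertAt-punchIn s′ k₀ x j′))))

  grid : ℤ → (i : ℕ) → Fin (2 ^ (i ∸ p)) → ℤ
  grid a i t = a ℤ.+ + (toℕ t * 2 ^ p)

  2^[i∸p]*2^p≡2^i : ∀ {i} → p ≤ i → 2 ^ (i ∸ p) * 2 ^ p ≡ 2 ^ i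
  2^[i∸p]*2^p≡2^i {i} p≤i = trans (sym (ℕₚ.^-distribˡ-+-* 2 (i ∸ p) p)) (cong (2 ^_) (ℕₚ.m∸n+n≡m p≤i))

  grid-slot : ∀ {a i} → +2^ i ∣ a → p ≤ i → ∀ t → Slot (dyadic a i) (grid a i t)
  grid-slot {a} {i} 2^i∣a p≤i t =
    ∣m∣n⇒∣m+n (∣-trans (2^∣2^ p≤i) 2^i∣a) (divides (+ toℕ t) (ℤₚ.pos-* (toℕ t) (2 ^ p))) ,
    ℤₚ.i≤i+j a (+ (toℕ t * 2 ^ p)) ,
    (begin
      a ℤ.+ + (toℕ t * 2 ^ p) ℤ.+ +2^ p   ≡⟨ ℤₚ.+-assoc a (+ (toℕ t * 2 ^ p)) (+2^ p) ⟩
      a ℤ.+ (+ (toℕ t * 2 ^ p) ℤ.+ +2^ p) ≡⟨ cong (λ x → a ℤ.+ x) (ℤₚ.pos-+ (toℕ t * 2 ^ p) (2 ^ p)) ⟨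
      a ℤ.+ + (toℕ t * 2 ^ p + 2 ^ p)     ≤⟨ ℤₚ.+-monoʳ-≤ a (ℤ.+≤+ last-fits) ⟩
      a ℤ.+ +2^ i                         ∎)
    where
    open ℤₚ.≤-Reasoning
    last-fits : toℕ t * 2 ^ p + 2 ^ p ≤ 2 ^ i
    last-fits = ℕₚ.≤-trans (ℕₚ.≤-reflexive (ℕₚ.+-comm (toℕ t * 2 ^ p) (2 ^ p)))
                  (subst (suc (toℕ t) * 2 ^ p ≤_) (2^[i∸p]*2^p≡2^i p≤i) (ℕₚ.*-monoˡ-≤ (2 ^ p) (Finₚ.toℕ<n t)))

  grid-injective : ∀ a i → Injective _≡_ _≡_ (grid a i)
  grid-injective a i {t} {t′} eq = Finₚ.toℕ-injective (ℕₚ.*-cancelʳ-≡ (toℕ t) (toℕ t′) (2 ^ p)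
    (trans (sym (offset-+ a (toℕ t * 2 ^ p))) (trans (cong (offset a) eq) (offset-+ a (toℕ t′ * 2 ^ p)))))

  full-grid⇒≤inside : ∀ {a i} (w : Fin n → Window) (e : Fin n → ℕ) → (∀ k → e k ≤ i) →
                      (∀ k → AlignedAt (e k) (w k)) → +2^ i ∣ a → p ≤ i →
                      ((s , _) : Schedule w) → (∀ t → ∃ λ k → s k ≡ grid a i t) →
                      2 ^ (i ∸ p) ≤ inside w (dyadic a i)
  full-grid⇒≤inside {a = a} {i} w e e≤i al 2^i∣a p≤i (s , s-slot , _) full = begin
    2 ^ (i ∸ p)                             ≡⟨ #-all (λ (_ : Fin (2 ^ (i ∸ p))) → yes tt) (λ _ → tt) ⟨
    # (λ (_ : Fin (2 ^ (i ∸ p))) → yes tt)  ≤⟨ #-injective _ (λ k → w k ⊑? dyadic a i) (λ t _ → proj₁ (full t))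
                                                 (λ t _ → occupant-inside t) occupant-injective ⟩
    inside w (dyadic a i)                   ∎
    where
    open ℕₚ.≤-Reasoning
    occupant-inside : ∀ t → w (proj₁ (full t)) ⊑ dyadic a i
    occupant-inside t = aligned-laminar (e≤i k) (al k) (aligned refl 2^i∣a) (slot⇒∈ʷ (s-slot k))
                          (subst (_∈ʷ dyadic a i) (sym (proj₂ (full t))) (slot⇒∈ʷ (grid-slot 2^i∣a p≤i t)))
      where
      k : Fin _
      k = proj₁ (full t)
    occupant-injective : ∀ {t t′} (_ _ : ⊤) → proj₁ (full t) ≡ proj₁ (full t′) → t ≡ t′
    occupant-injective {t} {t′} _ _ eq = grid-injective a i (trans (sym (proj₂ (full t))) (trans (cong s eq) (proj₂ (full t′))))

  -- Schedule all jobs but one with the longest window; if its whole grid were taken,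
  -- its window would violate the Hall condition.
  schedule : (w : Fin n → Window) (e : Fin n → ℕ) → (∀ k → p ≤ e k) → (∀ k → AlignedAt (e k) (w k)) →
             (∀ i a → +2^ i ∣ a → inside w (dyadic a i) * 2 ^ p ≤ 2 ^ i) → Schedule w
  schedule {zero}  w e p≤e al hall = (λ ()) , (λ ()) , λ { {()} }
  schedule {suc n} w e p≤e al hall = place (Finₚ.all? (λ t → Finₚ.any? (λ k → s′ k ℤₚ.≟ grid a₀ i₀ t)))
    where
    k₀ : Fin (suc n)
    k₀ = proj₁ (argmax e)
    i₀ : ℕ
    i₀ = e k₀
    a₀ : ℤ
    a₀ = arrival (w k₀)
    D : Window
    D = dyadic a₀ i₀
    w′ : Fin n → Window
    w′ = removeAt w k₀
    w≡D : w k₀ ≡ D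
    w≡D = alignedAt⇒≡dyadic (al k₀)
    2^i₀∣a₀ : +2^ i₀ ∣ a₀
    2^i₀∣a₀ = AlignedAt.2^∣arrival (al k₀)
    inside≡ : ∀ V → inside w V ≡ 𝟙 (w k₀ ⊑? V) + inside w′ V
    inside≡ V = #-punchIn (λ k → w k ⊑? V) k₀
    hall′ : ∀ i a → +2^ i ∣ a → inside w′ (dyadic a i) * 2 ^ p ≤ 2 ^ i
    hall′ i a 2^i∣a = ℕₚ.≤-trans
      (ℕₚ.*-monoˡ-≤ (2 ^ p) (subst (inside w′ (dyadic a i) ≤_) (sym (inside≡ (dyadic a i))) (ℕₚ.m≤n+m _ _)))
      (hall i a 2^i∣a)
    rest : Schedule w′
    rest = schedule w′ (removeAt e k₀) (p≤e ∘ punchIn k₀) (al ∘ punchIn k₀) hall′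
    s′ : Fin n → ℤ
    s′ = proj₁ rest
    place : Dec (∀ t → ∃ λ k → s′ k ≡ grid a₀ i₀ t) → Schedule w
    place (no not-full) with Finₚ.¬∀⟶∃¬ _ _ (λ t → Finₚ.any? (λ k → s′ k ℤₚ.≟ grid a₀ i₀ t)) not-full
    ... | t , free = insertAt-schedule w k₀ (subst (λ W → Slot W (grid a₀ i₀ t)) (sym w≡D) (grid-slot 2^i₀∣a₀ (p≤e k₀) t))
                       rest (λ k eq → free (k , eq))
    place (yes full) = contradiction (hall i₀ a₀ 2^i₀∣a₀) (ℕₚ.<⇒≱ (begin-strict
      2 ^ i₀                                 ≡⟨ 2^[i∸p]*2^p≡2^i (p≤e k₀) ⟨
      2 ^ (i₀ ∸ p) * 2 ^ p                   <⟨ ℕₚ.*-monoˡ-< (2 ^ p) (s≤s grid≤inside) ⟩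
      suc (inside w′ D) * 2 ^ p              ≡⟨ cong (λ c → (c + inside w′ D) * 2 ^ p) (𝟙-yes (w k₀ ⊑? D) (⊑-reflexive w≡D)) ⟨
      (𝟙 (w k₀ ⊑? D) + inside w′ D) * 2 ^ p  ≡⟨ cong (_* 2 ^ p) (inside≡ D) ⟨
      inside w D * 2 ^ p                     ∎))
      where
      open ℕₚ.≤-Reasoning
      grid≤inside : 2 ^ (i₀ ∸ p) ≤ inside w′ D
      grid≤inside = full-grid⇒≤inside w′ (removeAt e k₀) (proj₂ (argmax e) ∘ punchIn k₀) (al ∘ punchIn k₀)
                                      2^i₀∣a₀ (p≤e k₀) rest full

  single-machine : ∀ {γ} {J : List Window} → γ ≤ 2 ^ p → Schedule (lookup J) → Underallocated 1 γ J
  single-machine {γ} {J} γ≤2^p (s , s-slot , s-injective) = (λ _ → Fin.zero) , s , fits , disjoint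
    where
    +γ≤+2^p : ∀ x → x ℤ.+ + γ ℤ.≤ x ℤ.+ +2^ p
    +γ≤+2^p x = ℤₚ.+-monoʳ-≤ x (ℤ.+≤+ γ≤2^p)
    fits : ∀ k → (arrival (lookup J k) ℤ.≤ s k) × (s k ℤ.+ + γ ℤ.≤ deadline (lookup J k))
    fits k = proj₁ (proj₂ (s-slot k)) , ℤₚ.≤-trans (+γ≤+2^p (s k)) (proj₂ (proj₂ (s-slot k)))
    disjoint : ∀ k l → k ≢ l → Fin.zero ≡ Fin.zero → (s k ℤ.+ + γ ℤ.≤ s l) ⊎ (s l ℤ.+ + γ ℤ.≤ s k)
    disjoint k l k≢l _ with ℤₚ.<-cmp (s k) (s l)
    ... | tri< sk<sl _ _ = inj₁ (ℤₚ.≤-trans (+γ≤+2^p (s k)) (∣∣<⇒+≤ (proj₁ (s-slot k)) (proj₁ (s-slot l)) sk<sl))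
    ... | tri≈ _ sk≡sl _ = contradiction (s-injective sk≡sl) k≢l
    ... | tri> _ _ sl<sk = inj₂ (ℤₚ.≤-trans (+γ≤+2^p (s l)) (∣∣<⇒+≤ (proj₁ (s-slot l)) (proj₁ (s-slot k)) sl<sk))

2^-between : ∀ n .{{_ : NonZero n}} → ∃ λ p → n ≤ 2 ^ p × 2 ^ p ≤ 2 * n
2^-between (suc zero) = 0 , ℕₚ.≤-refl , s≤s z≤n
2^-between (suc (suc n)) with 2^-between (suc n)
... | p , 1+n≤2^p , 2^p≤2[1+n] with suc (suc n) ℕ.≤? 2 ^ p
...   | yes 2+n≤2^p = p , 2+n≤2^p , ℕₚ.≤-trans 2^p≤2[1+n] (ℕₚ.*-monoʳ-≤ 2 (ℕₚ.n≤1+n (suc n)))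
...   | no 2+n≰2^p  = suc p , 2+n≤2^[1+p] , ℕₚ.*-monoʳ-≤ 2 (ℕₚ.m≤n⇒m≤1+n (ℕ.s≤s⁻¹ (ℕₚ.≰⇒> 2+n≰2^p)))
  where
  2+n≤2^[1+p] : suc (suc n) ≤ 2 ^ suc p
  2+n≤2^[1+p] = ℕₚ.≤-trans (subst (suc (suc n) ≤_) (2+n+n≡2[1+n] n) (ℕₚ.m≤m+n (suc (suc n)) n)) (ℕₚ.*-monoʳ-≤ 2 1+n≤2^p)
    where
    2+n+n≡2[1+n] : ∀ n → suc (suc n) + n ≡ 2 * suc n
    2+n+n≡2[1+n] = ℕ-Solver.solve-∀

2^-cancel-≤ : ∀ {i j} → 2 ^ i ≤ 2 ^ j → i ≤ j
2^-cancel-≤ 2^i≤2^j = ℕₚ.≮⇒≥ (λ j<i → ℕₚ.<⇒≱ (ℕₚ.^-monoʳ-< 2 (s≤s (s≤s z≤n)) j<i) 2^i≤2^j)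

6γ*N≤3*2^⇒N*2^p≤2^ : ∀ γ p N i → 2 ^ p ≤ 2 * γ → 6 * γ * N ≤ 3 * 2 ^ i → N * 2 ^ p ≤ 2 ^ i
6γ*N≤3*2^⇒N*2^p≤2^ γ p N i 2^p≤2γ 6γN≤3*2^i = ℕₚ.*-cancelˡ-≤ 3 (begin
  3 * (N * 2 ^ p)    ≤⟨ ℕₚ.*-monoʳ-≤ 3 (ℕₚ.*-monoʳ-≤ N 2^p≤2γ) ⟩
  3 * (N * (2 * γ))  ≡⟨ 3[x[2y]]≡6y*x N γ ⟩
  6 * γ * N          ≤⟨ 6γN≤3*2^i ⟩
  3 * 2 ^ i          ∎)
  where
  open ℕₚ.≤-Reasoning
  3[x[2y]]≡6y*x : ∀ x y → 3 * (x * (2 * y)) ≡ 6 * y * x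
  3[x[2y]]≡6y*x = ℕ-Solver.solve-∀

lemma2 : (m γ : ℕ) → .{{_ : NonZero m}} → .{{_ : NonZero γ}} →
    (J J′ : List Window) →
    RecursivelyAligned J →
    Underallocated m (6 * γ) J →
    J′ ⊆ J →
    (∀ (W : Window) → count W J′ ≤ ⌈ count W J / m ⌉) →
    Underallocated 1 γ J′
lemma2 m γ J J′ J-aligned U J′⊆J J′-few with 2^-between γ
... | p , γ≤2^p , 2^p≤2γ = single-machine p {J = J′} γ≤2^p (schedule p (lookup J′) j′ p≤j′ J′-aligned hall)
  where
  instance
    6γ≢0 : NonZero (6 * γ)
    6γ≢0 = ℕₚ.m*n≢0 6 γ
  long′ : ∀ k → LongAligned (6 * γ) (lookup J′ k)
  long′ = lookup-⊆ {P = LongAligned (6 * γ)} J′⊆J (underallocated⇒longAligned {J = J} J-aligned U)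
  j′ : Fin (length J′) → ℕ
  j′ = proj₁ ∘ long′
  J′-aligned : ∀ k → AlignedAt (j′ k) (lookup J′ k)
  J′-aligned = proj₁ ∘ proj₂ ∘ long′
  p≤j′ : ∀ k → p ≤ j′ k
  p≤j′ k = 2^-cancel-≤ (ℕₚ.≤-trans 2^p≤2γ (ℕₚ.≤-trans (ℕₚ.*-monoˡ-≤ γ {2} {6} (s≤s (s≤s z≤n)))
                                                       (proj₂ (proj₂ (long′ k)))))
  hall : ∀ i a → +2^ i ∣ a → inside (lookup J′) (dyadic a i) * 2 ^ p ≤ 2 ^ i
  hall i a 2^i∣a = 6γ*N≤3*2^⇒N*2^p≤2^ γ p (inside (lookup J′) (dyadic a i)) i 2^p≤2γ
    (L*N′≤3*2^ {J = J} {J′ = J′} U (aligned⇒alignedAt ∘ J-aligned) (λ k → j′ k , J′-aligned k) J′-few i a 2^i∣a)
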